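{- Let $n,q$ be positive integers with $n$ even, $n\ge4$, $q\ge2$. Any $3$-design $C$ in $H(n,q)$ with degree $2$ and degree set $\{n/2,n\}$ is isomorphic to the Hadamard code of a Hadamard matrix of order $n$.
   Context: $[q]=\{1,\ldots,q\}$; $\partial$ is Hamming distance. A nonempty $C\subseteq[q]^n$ is a $t$-design in the Hamming scheme $H(n,q)$ if the array of its elements (as rows) is an orthogonal array of strength $t$: in any $t$ columns every element of $[q]^t$ occurs equally often. Its degree set is $\{\partial(x,y):x,y\in C,x\ne y\}$ and its degree is the size of that set. For a Hadamard matrix $H$ of order $n$ (an $n\times n$ $\pm1$ matrix with $HH^\top=nI$), its Hadamard code is the set of $2n$ vectors in $\{1,2\}^n$ obtained from the rows of $H$ and of $-H$ by replacing each entry $1$ by $1$ and each entry $-1$ by $2$. Two codes are isomorphic if one is obtained from the other by permuting coordinates and permuting symbols within each coordinate. -}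

module Defs where

open import Data.Nat using (ℕ; zero; suc; _*_; _+_)
open import Data.Integer as ℤ using (ℤ; +_; -[1+_])
open import Data.Fin using (Fin; zero; suc)
open import Data.Fin.Properties using (all?)
open import Data.Fin.Permutation using (Permutation′; _⟨$⟩ʳ_)
open import Data.Vec using (Vec; lookup; tabulate)
open import Data.List using (List; length; filter; allFin; foldr; map)
open import Data.List.Membership.Propositional using (_∈_)
open import Data.Product using (Σ; ∃; _×_; _,_)
open import Data.Sum using (_⊎_)
open import Relation.Nullary using (¬_; ¬?)
open import Relation.Binary.PropositionalEquality using (_≡_; _≢_)
import Data.Fin.Properties as FinP
open import Data.Integer.Properties using () renaming (_≟_ to _≟ℤ_)

-- A word of length n over the alphabet [q] (symbol i of [q] is Fin q element i-1).
Word : ℕ → ℕ → Set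
Word n q = Vec (Fin q) n

dist : ∀ {n q} → Word n q → Word n q → ℕ
dist {n} x y = length (filter (λ i → ¬? (lookup x i FinP.≟ lookup y i)) (allFin n))

countPattern : ∀ {n q t} → List (Word n q) → (Fin t → Fin n) → (Fin t → Fin q) → ℕ
countPattern C s a = length (filter (λ c → all? (λ j → lookup c (s j) FinP.≟ a j)) C)

-- C is a t-design in H(n,q): C (rows) is an orthogonal array of strength t,
-- i.e. for every choice of t distinct columns, every element of [q]^t occurs
-- equally often.
IsDesign : ∀ {n q} (t : ℕ) → List (Word n q) → Set
IsDesign {n} {q} t C =
  (s : Fin t → Fin n) → (∀ i j → s i ≡ s j → i ≡ j) →
  (a b : Fin t → Fin q) → countPattern C s a ≡ countPattern C s b

InDegreeSet : ∀ {n q} → List (Word n q) → ℕ → Set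
InDegreeSet {n} {q} C d =
  Σ (Word n q) λ x → Σ (Word n q) λ y → x ∈ C × y ∈ C × x ≢ y × dist x y ≡ d

sumFin : ∀ n → (Fin n → ℤ) → ℤ
sumFin n f = foldr ℤ._+_ (+ 0) (map f (allFin n))

IsHadamard : ∀ n → (Fin n → Fin n → ℤ) → Set
IsHadamard n H =
  (∀ i j → H i j ≡ + 1 ⊎ H i j ≡ -[1+ 0 ]) ×
  (∀ i → sumFin n (λ k → H i k ℤ.* H i k) ≡ + n) ×
  (∀ i j → i ≢ j → sumFin n (λ k → H i k ℤ.* H j k) ≡ + 0)

sym1 sym2 : ∀ {r} → Fin (suc (suc r))
sym1 = zero
sym2 = suc zero

toSym : ∀ {r} → ℤ → Fin (suc (suc r))
toSym (+ 1) = sym1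
toSym _     = sym2

-- Membership in the Hadamard code of H (rows of H and of -H, converted),
-- viewed inside [q]^n since {1,2} ⊆ [q].
InHadamardCode : ∀ {n r} → (Fin n → Fin n → ℤ) → Word n (suc (suc r)) → Set
InHadamardCode {n} H y =
  ∃ λ (i : Fin n) →
    (y ≡ tabulate (λ k → toSym (H i k))) ⊎ (y ≡ tabulate (λ k → toSym (ℤ.- H i k)))

isoMap : ∀ {n q} → Permutation′ n → (Fin n → Permutation′ q) → Word n q → Word n q
isoMap σ π x = tabulate (λ k → π k ⟨$⟩ʳ lookup x (σ ⟨$⟩ʳ k))

{-# OPTIONS --safe #-}
module Submission where

-- Fix a codeword x and let a(c) be the number of coordinates in which c ∈ C agrees with x.
-- Since C is an orthogonal array of strength 3, hence of strength 2 with index P = N/q²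
-- (N = |C|), the first two moments of a are determined:  q Σ a = n N  and
-- q² Σ a² = n (n + q - 1) N.  As the degree set is {m, n} with n = 2m, a only takes the
-- values n (at c = x), m and 0, so the moments are linear in the numbers b and z of
-- codewords with a = m and a = 0.  Together with N = 1 + b + z and N = q² P this forces
-- m (1 + r P) = (1 + r) P for q = 2 + r, which for m ≥ 2 only has the solution
-- q = 2, P = m, and then z = 1.  So C is closed under complementation and N = 2n; the n
-- codewords with symbol 1 in a fixed coordinate pairwise agree in exactly m places, so as
-- ±1 vectors they are the rows of a Hadamard matrix H, and C consists of the rows of H
-- and -H.

open import Defs
import Algebra.Properties.Semiring.Sum as Sum
open import Data.Bool.Base using (Bool; true; false; _∧_)
open import Data.Empty using (⊥-elim)
open import Data.Fin.Base using (Fin; zero; suc; opposite; cast; fromℕ<)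
import Data.Fin.Properties as Fin
open import Data.Fin.Properties using (opposite-involutive; cast-involutive)
open import Data.Fin.Permutation using (Permutation′)
import Data.Fin.Permutation as Perm
open import Data.Integer.Base as ℤ using (ℤ; +_; -[1+_])
import Data.Integer.Properties as ℤ
open import Algebra.Properties.CommutativeSemigroup ℤ.+-commutativeSemigroup using (interchange)
open import Algebra.Properties.AbelianGroup ℤ.+-0-abelianGroup using (identityˡ-unique)
open import Data.List.Base using (List; []; _∷_; length; filter; lookup; tabulate; foldr; map)
open import Data.List.Properties using (map-tabulate; map-cong; map-id)
open import Data.List.Membership.Propositional using (_∈_)
open import Data.List.Membership.Propositional.Properties using (∈-lookup; ∈-filter⁺; ∈-filter⁻)
open import Data.List.Relation.Unary.All using () renaming (lookup to All-lookup)
open import Data.List.Relation.Unary.AllPairs using (_∷_)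
open import Data.List.Relation.Unary.Any using (here; there; index)
open import Data.List.Relation.Unary.Any.Properties using (lookup-index)
open import Data.List.Relation.Unary.Unique.Propositional using (Unique)
open import Data.List.Relation.Unary.Unique.Propositional.Properties using (filter⁺)
open import Data.Nat.Base using (ℕ; zero; suc; _+_; _*_; _≤_; s≤s; z≤n; NonZero; >-nonZero)
import Data.Nat.Properties as ℕ
open import Data.Nat.Properties
  using (+-*-semiring; +-identityʳ; +-comm; *-identityˡ; *-identityʳ; +-cancelˡ-≡; +-cancelʳ-≡; *-cancelˡ-≡;
         m+n≡0⇒m≡0; m+n≡0⇒n≡0; m+1+n≢m; ≤-trans; n≤1+n; m<n⇒n≢0; 1+n≢0)
open import Data.Nat.Tactic.RingSolver using (solve)
open import Data.Product.Base using (Σ; ∃; _×_; _,_; proj₁; proj₂)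
open import Data.Sum.Base using (_⊎_; inj₁; inj₂)
import Data.Vec.Base as V
open import Data.Vec.Properties using (≡-dec; tabulate∘lookup; lookup∘tabulate; tabulate-cong)
open import Function.Base using (_∘_)
open import Function.Bundles using (_⇔_; mk⇔; Equivalence)
open import Relation.Binary.Definitions using (DecidableEquality)
open import Relation.Binary.PropositionalEquality
  using (_≡_; _≢_; refl; sym; trans; cong; cong₂; subst; module ≡-Reasoning)
open import Relation.Nullary.Decidable using (Dec; yes; no; does; ¬?)
open import Relation.Nullary.Negation using (¬_)
open import Relation.Unary using (Decidable)

open Sum +-*-semiring
  using (sum; sum-syntax; sum-cong-≗; sum-replicate-zero; ∑-distrib-+; ∑-comm; *-distribˡ-sum; *-distribʳ-sum)

𝟙 : Bool → ℕ
𝟙 true  = 1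
𝟙 false = 0

[_] : ∀ {p} {P : Set p} → Dec P → ℕ
[ P? ] = 𝟙 (does P?)

module _ {p} {P : Set p} where

  [yes] : P → (P? : Dec P) → [ P? ] ≡ 1
  [yes] x (yes _) = refl
  [yes] x (no ¬x) = ⊥-elim (¬x x)

  [no] : ¬ P → (P? : Dec P) → [ P? ] ≡ 0
  [no] ¬x (yes x) = ⊥-elim (¬x x)
  [no] ¬x (no _)  = refl

  []≢0⇒ : (P? : Dec P) → [ P? ] ≢ 0 → P
  []≢0⇒ (yes x) _   = x
  []≢0⇒ (no _)  ≢0 = ⊥-elim (≢0 refl)

  []≡0⇒¬ : (P? : Dec P) → [ P? ] ≡ 0 → ¬ P
  []≡0⇒¬ (no ¬x) _ = ¬x

  []-idem : (P? : Dec P) → [ P? ] * [ P? ] ≡ [ P? ]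
  []-idem (yes _) = refl
  []-idem (no _)  = refl

  []+[¬]≡1 : (P? : Dec P) → [ P? ] + [ ¬? P? ] ≡ 1
  []+[¬]≡1 (yes _) = refl
  []+[¬]≡1 (no _)  = refl

[]-cong : ∀ {p q} {P : Set p} {Q : Set q} → (P → Q) → (Q → P) → (P? : Dec P) (Q? : Dec Q) → [ P? ] ≡ [ Q? ]
[]-cong P→Q Q→P P? (yes y) = [yes] (Q→P y) P?
[]-cong P→Q Q→P P? (no ¬y) = [no] (¬y ∘ P→Q) P?

𝟙-∧₃ : ∀ a b c → 𝟙 (a ∧ b ∧ c ∧ true) ≡ 𝟙 a * 𝟙 b * 𝟙 c
𝟙-∧₃ true  true  true  = refl
𝟙-∧₃ true  true  false = refl
𝟙-∧₃ true  false _     = refl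
𝟙-∧₃ false _     _     = refl

∑-const : ∀ n c → ∑[ i < n ] c ≡ n * c
∑-const zero    c = refl
∑-const (suc n) c = cong (_+_ c) (∑-const n c)

∑-[≟] : ∀ {n} (i : Fin n) → ∑[ j < n ] [ i Fin.≟ j ] ≡ 1
∑-[≟] {suc n} zero    = cong suc (sum-replicate-zero n)
∑-[≟] {suc n} (suc i) = ∑-[≟] i

∑-[≟]-* : ∀ {n} (i : Fin n) c → ∑[ j < n ] ([ i Fin.≟ j ] * c) ≡ c
∑-[≟]-* i c = trans (sym (*-distribʳ-sum c (λ j → [ i Fin.≟ j ]))) (trans (cong (_* c) (∑-[≟] i)) (+-identityʳ c))

∑*∑ : ∀ {m n} (f : Fin m → ℕ) (g : Fin n → ℕ) →
  ∑[ i < m ] f i * ∑[ j < n ] g j ≡ ∑[ i < m ] ∑[ j < n ] (f i * g j)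
∑*∑ f g = trans (*-distribʳ-sum (sum g) f) (sum-cong-≗ λ i → *-distribˡ-sum (f i) g)

∑≡0⇒ : ∀ {n} (f : Fin n → ℕ) → ∑[ i < n ] f i ≡ 0 → ∀ i → f i ≡ 0
∑≡0⇒ f ∑≡0 zero    = m+n≡0⇒m≡0 (f zero) ∑≡0
∑≡0⇒ f ∑≡0 (suc i) = ∑≡0⇒ (f ∘ suc) (m+n≡0⇒n≡0 (f zero) ∑≡0) i

∑≢0⇒ : ∀ {n} (f : Fin n → ℕ) → ∑[ i < n ] f i ≢ 0 → ∃ λ i → f i ≢ 0
∑≢0⇒ {zero}  f ∑≢0 = ⊥-elim (∑≢0 refl)
∑≢0⇒ {suc n} f ∑≢0 with f zero ℕ.≟ 0
... | no f₀≢0 = zero , f₀≢0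
... | yes f₀≡0 with ∑≢0⇒ (f ∘ suc) (λ ∑≡0 → ∑≢0 (cong₂ _+_ f₀≡0 ∑≡0))
...   | i , fᵢ≢0 = suc i , fᵢ≢0

length-filter-tabulate : ∀ {a p} {A : Set a} {P : A → Set p} (P? : Decidable P) {n} (f : Fin n → A) →
  length (filter P? (tabulate f)) ≡ ∑[ i < n ] [ P? (f i) ]
length-filter-tabulate P? {zero}  f = refl
length-filter-tabulate P? {suc n} f with does (P? (f zero))
... | true  = cong suc (length-filter-tabulate P? (f ∘ suc))
... | false = length-filter-tabulate P? (f ∘ suc)

module _ {a} {A : Set a} where

  ∑ₗ : List A → (A → ℕ) → ℕ
  ∑ₗ xs f = ∑[ i < length xs ] f (lookup xs i)

  infixl 10 ∑ₗ
  syntax ∑ₗ xs (λ x → e) = ∑[ x ← xs ] e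

  length-filter : ∀ {p} {P : A → Set p} (P? : Decidable P) xs → length (filter P? xs) ≡ ∑[ x ← xs ] [ P? x ]
  length-filter P? []       = refl
  length-filter P? (x ∷ xs) with does (P? x)
  ... | true  = cong suc (length-filter P? xs)
  ... | false = length-filter P? xs

  lookup-injective : ∀ {xs : List A} → Unique xs → ∀ i j → lookup xs i ≡ lookup xs j → i ≡ j
  lookup-injective {_ ∷ _} _            zero    zero    _  = refl
  lookup-injective {_ ∷ _} (x∉ ∷ _)     zero    (suc j) eq = ⊥-elim (All-lookup x∉ (∈-lookup j) eq)
  lookup-injective {_ ∷ _} (x∉ ∷ _)     (suc i) zero    eq = ⊥-elim (All-lookup x∉ (∈-lookup i) (sym eq))
  lookup-injective {_ ∷ _} (_ ∷ unique) (suc i) (suc j) eq = cong suc (lookup-injective unique i j eq)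

  ∑-[≟]-unique : (_≟_ : DecidableEquality A) {xs : List A} → Unique xs → ∀ {x} → x ∈ xs →
    ∑[ y ← xs ] [ y ≟ x ] ≡ 1
  ∑-[≟]-unique _≟_ {y ∷ ys} (y∉ ∷ _) (here refl) = cong₂ _+_ ([yes] refl (y ≟ y)) (begin
    ∑[ z ← ys ] [ z ≟ y ] ≡⟨ sum-cong-≗ (λ i → [no] (All-lookup y∉ (∈-lookup i) ∘ sym) (lookup ys i ≟ y)) ⟩
    ∑[ i < length ys ] 0  ≡⟨ sum-replicate-zero (length ys) ⟩
    0                     ∎)
    where open ≡-Reasoning
  ∑-[≟]-unique _≟_ {y ∷ ys} (y∉ ∷ unique) {x} (there x∈ys) =
    cong₂ _+_ ([no] (All-lookup y∉ x∈ys) (y ≟ x)) (∑-[≟]-unique _≟_ unique x∈ys)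

  nonempty : {xs : List A} → xs ≢ [] → ∃ (_∈ xs)
  nonempty {[]}    []≢[] = ⊥-elim ([]≢[] refl)
  nonempty {x ∷ _} _     = x , here refl

module _ {n q : ℕ} where

  agreement : Word n q → Word n q → ℕ
  agreement c x = ∑[ i < n ] [ V.lookup c i Fin.≟ V.lookup x i ]

  dist≡∑ : (c x : Word n q) → dist c x ≡ ∑[ i < n ] [ ¬? (V.lookup c i Fin.≟ V.lookup x i) ]
  dist≡∑ c x = length-filter-tabulate (λ i → ¬? (V.lookup c i Fin.≟ V.lookup x i)) (λ i → i)

  agreement+dist≡n : (c x : Word n q) → agreement c x + dist c x ≡ n
  agreement+dist≡n c x = begin
    agreement c x + dist c x                          ≡⟨ cong (_+_ (agreement c x)) (dist≡∑ c x) ⟩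
    ∑[ i < n ] [ c≟x i ] + ∑[ i < n ] [ ¬? (c≟x i) ]  ≡⟨ ∑-distrib-+ (λ i → [ c≟x i ]) (λ i → [ ¬? (c≟x i) ]) ⟨
    ∑[ i < n ] ([ c≟x i ] + [ ¬? (c≟x i) ])           ≡⟨ sum-cong-≗ (λ i → []+[¬]≡1 (c≟x i)) ⟩
    ∑[ i < n ] 1                                      ≡⟨ trans (∑-const n 1) (*-identityʳ n) ⟩
    n                                                 ∎
    where
    open ≡-Reasoning
    c≟x : ∀ i → Dec (V.lookup c i ≡ V.lookup x i)
    c≟x i = V.lookup c i Fin.≟ V.lookup x i

  dist≡n⇒agreement≡0 : (c x : Word n q) → dist c x ≡ n → agreement c x ≡ 0
  dist≡n⇒agreement≡0 c x d≡n = +-cancelʳ-≡ n _ 0 (trans (cong (_+_ (agreement c x)) (sym d≡n)) (agreement+dist≡n c x))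

  agreement-self : (x : Word n q) → agreement x x ≡ n
  agreement-self x = trans (sum-cong-≗ λ i → [yes] refl (V.lookup x i Fin.≟ V.lookup x i)) (trans (∑-const n 1) (*-identityʳ n))

  dist-self : (x : Word n q) → dist x x ≡ 0
  dist-self x = trans (dist≡∑ x x)
    (trans (sum-cong-≗ λ i → [no] (λ x≢x → x≢x refl) (¬? (V.lookup x i Fin.≟ V.lookup x i))) (sum-replicate-zero n))

  agreement≡0⇒ : (c x : Word n q) → agreement c x ≡ 0 → ∀ i → V.lookup c i ≢ V.lookup x i
  agreement≡0⇒ c x a≡0 i = []≡0⇒¬ (V.lookup c i Fin.≟ V.lookup x i) (∑≡0⇒ _ a≡0 i)

  DegreesIn : List (Word n q) → ℕ → ℕ → Set
  DegreesIn C d₁ d₂ = ∀ {c c′} → c ∈ C → c′ ∈ C → c ≢ c′ → dist c c′ ≡ d₁ ⊎ dist c c′ ≡ d₂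

  degreeSet⇒DegreesIn : ∀ {C d₁ d₂} → ((d : ℕ) → InDegreeSet C d ⇔ (d ≡ d₁ ⊎ d ≡ d₂)) → DegreesIn C d₁ d₂
  degreeSet⇒DegreesIn degree-set c∈C c′∈C c≢c′ = Equivalence.to (degree-set _) (_ , _ , c∈C , c′∈C , c≢c′ , refl)

fresh : ∀ {n} → 3 ≤ n → (i j : Fin n) → ∃ λ k → i ≢ k × j ≢ k
fresh (s≤s (s≤s (s≤s _))) zero          zero          = suc zero , (λ ()) , (λ ())
fresh (s≤s (s≤s (s≤s _))) zero          (suc zero)    = suc (suc zero) , (λ ()) , (λ ())
fresh (s≤s (s≤s (s≤s _))) zero          (suc (suc _)) = suc zero , (λ ()) , (λ ())
fresh (s≤s (s≤s (s≤s _))) (suc zero)    zero          = suc (suc zero) , (λ ()) , (λ ())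
fresh (s≤s (s≤s (s≤s _))) (suc zero)    (suc zero)    = zero , (λ ()) , (λ ())
fresh (s≤s (s≤s (s≤s _))) (suc zero)    (suc (suc _)) = zero , (λ ()) , (λ ())
fresh (s≤s (s≤s (s≤s _))) (suc (suc _)) zero          = suc zero , (λ ()) , (λ ())
fresh (s≤s (s≤s (s≤s _))) (suc (suc _)) (suc _)       = zero , (λ ()) , (λ ())

triple : ∀ {a} {A : Set a} → A → A → A → Fin 3 → A
triple i j k zero             = i
triple i j k (suc zero)       = j
triple i j k (suc (suc zero)) = k

module _ {a} {A : Set a} {i j k : A} (i≢j : i ≢ j) (i≢k : i ≢ k) (j≢k : j ≢ k) where

  triple-injective : ∀ s t → triple i j k s ≡ triple i j k t → s ≡ t
  triple-injective zero             zero             _  = refl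
  triple-injective zero             (suc zero)       eq = ⊥-elim (i≢j eq)
  triple-injective zero             (suc (suc zero)) eq = ⊥-elim (i≢k eq)
  triple-injective (suc zero)       zero             eq = ⊥-elim (i≢j (sym eq))
  triple-injective (suc zero)       (suc zero)       _  = refl
  triple-injective (suc zero)       (suc (suc zero)) eq = ⊥-elim (j≢k eq)
  triple-injective (suc (suc zero)) zero             eq = ⊥-elim (i≢k (sym eq))
  triple-injective (suc (suc zero)) (suc zero)       eq = ⊥-elim (j≢k (sym eq))
  triple-injective (suc (suc zero)) (suc (suc zero)) _  = refl

module Design {n q} (C : List (Word n q)) (design : IsDesign 3 C) (3≤n : 3 ≤ n) where

  N : ℕ
  N = length C

  hit : Word n q → Fin n → Fin q → ℕ
  hit c i u = [ V.lookup c i Fin.≟ u ]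

  count : Fin n → Fin q → ℕ
  count i u = ∑[ c ← C ] hit c i u

  pairCount : Fin n → Fin n → Fin q → Fin q → ℕ
  pairCount i j u v = ∑[ c ← C ] (hit c i u * hit c j v)

  tripleCount : Fin n → Fin n → Fin n → Fin q → Fin q → Fin q → ℕ
  tripleCount i j k u v w = ∑[ c ← C ] (hit c i u * hit c j v * hit c k w)

  marginalise : ∀ (g : Word n q → ℕ) k → ∑[ c ← C ] g c ≡ ∑[ w < q ] ∑[ c ← C ] (g c * hit c k w)
  marginalise g k = begin
    ∑[ c ← C ] g c
      ≡⟨ sum-cong-≗ (λ l → sym (trans (cong (g (c l) *_) (∑-[≟] (V.lookup (c l) k))) (*-identityʳ _))) ⟩
    ∑[ c ← C ] (g c * ∑[ w < q ] hit c k w)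
      ≡⟨ sum-cong-≗ (λ l → *-distribˡ-sum (g (c l)) (hit (c l) k)) ⟩
    ∑[ c ← C ] ∑[ w < q ] (g c * hit c k w)
      ≡⟨ ∑-comm (λ l w → g (c l) * hit (c l) k w) ⟩
    ∑[ w < q ] ∑[ c ← C ] (g c * hit c k w) ∎
    where
    open ≡-Reasoning
    c : Fin N → Word n q
    c = lookup C

  length≡∑count : ∀ i → N ≡ ∑[ u < q ] count i u
  length≡∑count i = begin
    N                                      ≡⟨ trans (∑-const N 1) (*-identityʳ N) ⟨
    ∑[ c ← C ] 1                           ≡⟨ marginalise (λ _ → 1) i ⟩
    ∑[ u < q ] ∑[ c ← C ] (1 * hit c i u)  ≡⟨ sum-cong-≗ (λ u → sum-cong-≗ {N} λ l → *-identityˡ (hit (lookup C l) i u)) ⟩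
    ∑[ u < q ] count i u                   ∎
    where open ≡-Reasoning

  -- all? on Fin 3 computes to the conjunction of its three tests.
  tripleCount≡countPattern : ∀ i j k u v w → tripleCount i j k u v w ≡ countPattern C (triple i j k) (triple u v w)
  tripleCount≡countPattern i j k u v w = sym (trans (length-filter _ C) (sum-cong-≗ λ l →
    let c = lookup C l in
    𝟙-∧₃ (does (V.lookup c i Fin.≟ u)) (does (V.lookup c j Fin.≟ v)) (does (V.lookup c k Fin.≟ w))))

  module _ {i j k : Fin n} (i≢j : i ≢ j) (i≢k : i ≢ k) (j≢k : j ≢ k) where

    tripleCount-constant : ∀ u v w u′ v′ w′ → tripleCount i j k u v w ≡ tripleCount i j k u′ v′ w′
    tripleCount-constant u v w u′ v′ w′ = begin
      tripleCount i j k u v w                          ≡⟨ tripleCount≡countPattern i j k u v w ⟩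
      countPattern C (triple i j k) (triple u v w)     ≡⟨ design (triple i j k) (triple-injective i≢j i≢k j≢k) _ _ ⟩
      countPattern C (triple i j k) (triple u′ v′ w′)  ≡⟨ tripleCount≡countPattern i j k u′ v′ w′ ⟨
      tripleCount i j k u′ v′ w′                       ∎
      where open ≡-Reasoning

    pairCount≡q*tripleCount : ∀ u v u′ v′ w′ → pairCount i j u v ≡ q * tripleCount i j k u′ v′ w′
    pairCount≡q*tripleCount u v u′ v′ w′ = begin
      pairCount i j u v                      ≡⟨ marginalise (λ c → hit c i u * hit c j v) k ⟩
      ∑[ w < q ] tripleCount i j k u v w     ≡⟨ sum-cong-≗ (λ w → tripleCount-constant u v w u′ v′ w′) ⟩
      ∑[ w < q ] tripleCount i j k u′ v′ w′  ≡⟨ ∑-const q _ ⟩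
      q * tripleCount i j k u′ v′ w′         ∎
      where open ≡-Reasoning

    count≡q²*tripleCount : ∀ u u′ v′ w′ → count i u ≡ q * (q * tripleCount i j k u′ v′ w′)
    count≡q²*tripleCount u u′ v′ w′ = begin
      count i u                                    ≡⟨ marginalise (λ c → hit c i u) j ⟩
      ∑[ v < q ] pairCount i j u v                 ≡⟨ sum-cong-≗ (λ v → pairCount≡q*tripleCount u v u′ v′ w′) ⟩
      ∑[ v < q ] (q * tripleCount i j k u′ v′ w′)  ≡⟨ ∑-const q _ ⟩
      q * (q * tripleCount i j k u′ v′ w′)         ∎
      where open ≡-Reasoning

    length≡q³*tripleCount : ∀ u v w → N ≡ q * (q * (q * tripleCount i j k u v w))
    length≡q³*tripleCount u v w = begin
      N                                                ≡⟨ length≡∑count i ⟩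
      ∑[ u′ < q ] count i u′                           ≡⟨ sum-cong-≗ (λ u′ → count≡q²*tripleCount u′ u v w) ⟩
      ∑[ u′ < q ] (q * (q * tripleCount i j k u v w))  ≡⟨ ∑-const q _ ⟩
      q * (q * (q * tripleCount i j k u v w))          ∎
      where open ≡-Reasoning

  pairCount-index : ∀ {i j} → i ≢ j → ∀ u v → q * (q * pairCount i j u v) ≡ N
  pairCount-index {i} {j} i≢j u v with fresh 3≤n i j
  ... | k , i≢k , j≢k = trans (cong (λ t → q * (q * t)) (pairCount≡q*tripleCount i≢j i≢k j≢k u v u v u))
                              (sym (length≡q³*tripleCount i≢j i≢k j≢k u v u))

  count-index : ∀ i u → q * count i u ≡ N
  count-index i u with fresh 3≤n i i
  ... | j , i≢j , _ with fresh 3≤n i j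
  ...   | k , i≢k , j≢k = trans (cong (q *_) (count≡q²*tripleCount i≢j i≢k j≢k u u u u))
                                (sym (length≡q³*tripleCount i≢j i≢k j≢k u u u))

  module Moments (x : Word n q) where

    firstMoment : q * ∑[ c ← C ] agreement c x ≡ n * N
    firstMoment = begin
      q * ∑[ c ← C ] agreement c x             ≡⟨ cong (q *_) (∑-comm (λ l i → hit (lookup C l) i (V.lookup x i))) ⟩
      q * ∑[ i < n ] count i (V.lookup x i)    ≡⟨ *-distribˡ-sum q (λ i → count i (V.lookup x i)) ⟩
      ∑[ i < n ] (q * count i (V.lookup x i))  ≡⟨ sum-cong-≗ (λ i → count-index i (V.lookup x i)) ⟩
      ∑[ i < n ] N                             ≡⟨ ∑-const n N ⟩
      n * N                                    ∎
      where open ≡-Reasoning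

    private
      P : Fin n → Fin n → ℕ
      P i j = pairCount i j (V.lookup x i) (V.lookup x j)

      q²*-∑ : ∀ {k} (f : Fin k → ℕ) → q * (q * ∑[ i < k ] f i) ≡ ∑[ i < k ] (q * (q * f i))
      q²*-∑ f = trans (cong (q *_) (*-distribˡ-sum q f)) (*-distribˡ-sum q (λ i → q * f i))

    ∑agreement²≡∑P : ∑[ c ← C ] (agreement c x * agreement c x) ≡ ∑[ i < n ] ∑[ j < n ] P i j
    ∑agreement²≡∑P = begin
      ∑[ c ← C ] (agreement c x * agreement c x)        ≡⟨ sum-cong-≗ (λ l → ∑*∑ (h l) (h l)) ⟩
      ∑[ l < N ] ∑[ i < n ] ∑[ j < n ] (h l i * h l j)  ≡⟨ ∑-comm (λ l i → ∑[ j < n ] (h l i * h l j)) ⟩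
      ∑[ i < n ] ∑[ l < N ] ∑[ j < n ] (h l i * h l j)  ≡⟨ sum-cong-≗ (λ i → ∑-comm (λ l j → h l i * h l j)) ⟩
      ∑[ i < n ] ∑[ j < n ] P i j                       ∎
      where
      open ≡-Reasoning
      h : Fin N → Fin n → ℕ
      h l i = hit (lookup C l) i (V.lookup x i)

    P-index : ∀ i j → q * (q * P i j) + [ i Fin.≟ j ] * N ≡ N + [ i Fin.≟ j ] * (q * N)
    P-index i j with i Fin.≟ j
    ... | no i≢j   = cong (_+ 0) (pairCount-index i≢j _ _)
    ... | yes refl = begin
      q * (q * P i i) + (N + 0)
        ≡⟨ cong (λ t → q * (q * t) + (N + 0)) (sum-cong-≗ λ l → []-idem (V.lookup (lookup C l) i Fin.≟ V.lookup x i)) ⟩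
      q * (q * count i (V.lookup x i)) + (N + 0)  ≡⟨ cong (λ t → q * t + (N + 0)) (count-index i (V.lookup x i)) ⟩
      q * N + (N + 0)                             ≡⟨ cong (_+_ (q * N)) (+-identityʳ N) ⟩
      q * N + N                                   ≡⟨ +-comm (q * N) N ⟩
      N + q * N                                   ≡⟨ cong (_+_ N) (+-identityʳ (q * N)) ⟨
      N + (q * N + 0)                             ∎
      where open ≡-Reasoning

    P-rowSum : ∀ i → q * (q * ∑[ j < n ] P i j) + N ≡ n * N + q * N
    P-rowSum i = begin
      q * (q * ∑[ j < n ] P i j) + N
        ≡⟨ cong₂ _+_ (q²*-∑ (P i)) (sym (∑-[≟]-* i N)) ⟩
      ∑[ j < n ] (q * (q * P i j)) + ∑[ j < n ] ([ i Fin.≟ j ] * N)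
        ≡⟨ ∑-distrib-+ (λ j → q * (q * P i j)) (λ j → [ i Fin.≟ j ] * N) ⟨
      ∑[ j < n ] (q * (q * P i j) + [ i Fin.≟ j ] * N)
        ≡⟨ sum-cong-≗ (P-index i) ⟩
      ∑[ j < n ] (N + [ i Fin.≟ j ] * (q * N))
        ≡⟨ ∑-distrib-+ (λ _ → N) (λ j → [ i Fin.≟ j ] * (q * N)) ⟩
      ∑[ j < n ] N + ∑[ j < n ] ([ i Fin.≟ j ] * (q * N))
        ≡⟨ cong₂ _+_ (∑-const n N) (∑-[≟]-* i (q * N)) ⟩
      n * N + q * N ∎
      where open ≡-Reasoning

    -- That is, q² Σ a² = n (n + q - 1) N, stated without subtraction.
    secondMoment : q * (q * ∑[ c ← C ] (agreement c x * agreement c x)) + n * N ≡ n * (n * N + q * N)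
    secondMoment = begin
      q * (q * ∑[ c ← C ] (agreement c x * agreement c x)) + n * N
        ≡⟨ cong₂ _+_ (trans (cong (λ t → q * (q * t)) ∑agreement²≡∑P) (q²*-∑ (λ i → ∑[ j < n ] P i j)))
                     (sym (∑-const n N)) ⟩
      ∑[ i < n ] (q * (q * ∑[ j < n ] P i j)) + ∑[ i < n ] N
        ≡⟨ ∑-distrib-+ (λ i → q * (q * ∑[ j < n ] P i j)) (λ _ → N) ⟨
      ∑[ i < n ] (q * (q * ∑[ j < n ] P i j) + N)
        ≡⟨ sum-cong-≗ P-rowSum ⟩
      ∑[ i < n ] (n * N + q * N)
        ≡⟨ ∑-const n _ ⟩
      n * (n * N + q * N) ∎
      where open ≡-Reasoning

three-values : ∀ (F : ℕ → ℕ) {a n m} → n ≢ m → n ≢ 0 → m ≢ 0 → a ≡ n ⊎ a ≡ m ⊎ a ≡ 0 →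
  F a ≡ [ a ℕ.≟ n ] * F n + [ a ℕ.≟ m ] * F m + [ a ℕ.≟ 0 ] * F 0
three-values F {a} n≢m n≢0 m≢0 (inj₁ refl)
  rewrite [yes] refl (a ℕ.≟ a) | [no] n≢m (a ℕ.≟ _) | [no] n≢0 (a ℕ.≟ 0) =
    sym (trans (+-identityʳ _) (trans (+-identityʳ _) (+-identityʳ _)))
three-values F {a} n≢m n≢0 m≢0 (inj₂ (inj₁ refl))
  rewrite [no] (n≢m ∘ sym) (a ℕ.≟ _) | [yes] refl (a ℕ.≟ a) | [no] m≢0 (a ℕ.≟ 0) =
    sym (trans (+-identityʳ _) (+-identityʳ _))
three-values F {a} n≢m n≢0 m≢0 (inj₂ (inj₂ refl))
  rewrite [no] (n≢0 ∘ sym) (0 ℕ.≟ _) | [no] (m≢0 ∘ sym) (0 ℕ.≟ _) =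
    sym (+-identityʳ _)

module TwoDistance {n q m} (C : List (Word n q)) (unique : Unique C) (n≡2m : n ≡ 2 * m) (m≢0 : m ≢ 0)
  (degrees : DegreesIn C m n) {x : Word n q} (x∈C : x ∈ C) where

  private
    _≟W_ : DecidableEquality (Word n q)
    _≟W_ = ≡-dec Fin._≟_

    n≡m+m : n ≡ m + m
    n≡m+m = trans n≡2m (cong (_+_ m) (+-identityʳ m))

    n≢m : n ≢ m
    n≢m n≡m = m≢0 (+-cancelˡ-≡ m m 0 (trans (sym n≡m+m) (trans n≡m (sym (+-identityʳ m)))))

    n≢0 : n ≢ 0
    n≢0 n≡0 = m≢0 (m+n≡0⇒m≡0 m (trans (sym n≡m+m) n≡0))

  agreement-other : ∀ {c} → c ∈ C → c ≢ x → agreement c x ≡ m ⊎ agreement c x ≡ 0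
  agreement-other {c} c∈C c≢x with degrees c∈C x∈C c≢x
  ... | inj₁ d≡m = inj₁ (+-cancelʳ-≡ m _ _
    (trans (cong (_+_ (agreement c x)) (sym d≡m)) (trans (agreement+dist≡n c x) n≡m+m)))
  ... | inj₂ d≡n = inj₂ (dist≡n⇒agreement≡0 c x d≡n)

  agreement-values : ∀ {c} → c ∈ C → agreement c x ≡ n ⊎ agreement c x ≡ m ⊎ agreement c x ≡ 0
  agreement-values {c} c∈C with c ≟W x
  ... | yes refl = inj₁ (agreement-self x)
  ... | no c≢x   = inj₂ (agreement-other c∈C c≢x)

  agreement≡n⇒≡ : ∀ {c} → c ∈ C → agreement c x ≡ n → c ≡ x
  agreement≡n⇒≡ {c} c∈C a≡n with c ≟W x
  ... | yes c≡x = c≡x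
  ... | no c≢x with agreement-other c∈C c≢x
  ...   | inj₁ a≡m = ⊥-elim (n≢m (trans (sym a≡n) a≡m))
  ...   | inj₂ a≡0 = ⊥-elim (n≢0 (trans (sym a≡n) a≡0))

  halfCount antipodalCount : ℕ
  halfCount      = ∑[ c ← C ] [ agreement c x ℕ.≟ m ]
  antipodalCount = ∑[ c ← C ] [ agreement c x ℕ.≟ 0 ]

  ∑[agreement≟n]≡1 : ∑[ c ← C ] [ agreement c x ℕ.≟ n ] ≡ 1
  ∑[agreement≟n]≡1 = trans
    (sum-cong-≗ λ l → []-cong (agreement≡n⇒≡ (∈-lookup l)) (λ { refl → agreement-self x })
                               (agreement (lookup C l) x ℕ.≟ n) (lookup C l ≟W x))
    (∑-[≟]-unique _≟W_ unique x∈C)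

  moment-decomposition : ∀ (F : ℕ → ℕ) → ∑[ c ← C ] F (agreement c x) ≡ 1 * F n + halfCount * F m + antipodalCount * F 0
  moment-decomposition F = begin
    ∑[ c ← C ] F (agreement c x)
      ≡⟨ sum-cong-≗ (λ l → three-values F n≢m n≢0 m≢0 (agreement-values (∈-lookup l))) ⟩
    ∑[ c ← C ] ([ a≟ n c ] * F n + [ a≟ m c ] * F m + [ a≟ 0 c ] * F 0)
      ≡⟨ ∑-distrib-+ (λ l → [ a≟ n (c l) ] * F n + [ a≟ m (c l) ] * F m) (λ l → [ a≟ 0 (c l) ] * F 0) ⟩
    ∑[ c ← C ] ([ a≟ n c ] * F n + [ a≟ m c ] * F m) + ∑[ c ← C ] ([ a≟ 0 c ] * F 0)
      ≡⟨ cong (_+ ∑[ d ← C ] ([ a≟ 0 d ] * F 0))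
              (∑-distrib-+ (λ l → [ a≟ n (c l) ] * F n) (λ l → [ a≟ m (c l) ] * F m)) ⟩
    ∑[ c ← C ] ([ a≟ n c ] * F n) + ∑[ c ← C ] ([ a≟ m c ] * F m) + ∑[ c ← C ] ([ a≟ 0 c ] * F 0)
      ≡⟨ cong₂ _+_ (cong₂ _+_ (weight n) (weight m)) (weight 0) ⟨
    ∑[ c ← C ] [ a≟ n c ] * F n + halfCount * F m + antipodalCount * F 0
      ≡⟨ cong (λ t → t * F n + halfCount * F m + antipodalCount * F 0) ∑[agreement≟n]≡1 ⟩
    1 * F n + halfCount * F m + antipodalCount * F 0 ∎
    where
    open ≡-Reasoning
    c : Fin (length C) → Word n q
    c = lookup C
    a≟ : ∀ v (d : Word n q) → Dec (agreement d x ≡ v)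
    a≟ v d = agreement d x ℕ.≟ v
    weight : ∀ v → ∑[ d ← C ] [ a≟ v d ] * F v ≡ ∑[ d ← C ] ([ a≟ v d ] * F v)
    weight v = *-distribʳ-sum (F v) (λ l → [ a≟ v (c l) ])

module _ {q m b z P N : ℕ} .{{_ : NonZero q}} .{{_ : NonZero m}} (q²P≡N : q * (q * P) ≡ N) where
  open ≡-Reasoning

  first-moment-reduced : q * (1 * (2 * m) + b * m + z * 0) ≡ 2 * m * N → 2 + b ≡ 2 * (q * P)
  first-moment-reduced first = *-cancelˡ-≡ _ _ q (*-cancelˡ-≡ _ _ m (begin
    m * (q * (2 + b))                  ≡⟨ solve (m ∷ q ∷ b ∷ z ∷ []) ⟩
    q * (1 * (2 * m) + b * m + z * 0)  ≡⟨ first ⟩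
    2 * m * N                          ≡⟨ cong (2 * m *_) q²P≡N ⟨
    2 * m * (q * (q * P))              ≡⟨ solve (m ∷ q ∷ P ∷ []) ⟩
    m * (q * (2 * (q * P)))            ∎))

  second-moment-reduced : 2 + b ≡ 2 * (q * P) →
    q * (q * (1 * (2 * m * (2 * m)) + b * (m * m) + z * (0 * 0))) + 2 * m * N ≡ 2 * m * (2 * m * N + q * N) →
    m * (1 + q * P) + P ≡ 2 * m * P + q * P
  second-moment-reduced 2+b≡2qP second = *-cancelˡ-≡ _ _ q (*-cancelˡ-≡ _ _ q (*-cancelˡ-≡ _ _ m (*-cancelˡ-≡ _ _ 2 (begin
    2 * (m * (q * (q * (m * (1 + q * P) + P))))
      ≡⟨ solve (m ∷ q ∷ P ∷ []) ⟩
    m * (q * (q * (m * (2 + 2 * (q * P)))) + 2 * (q * (q * P)))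
      ≡⟨ cong₂ (λ s t → m * (q * (q * (m * (2 + s))) + 2 * t)) (sym 2+b≡2qP) q²P≡N ⟩
    m * (q * (q * (m * (2 + (2 + b)))) + 2 * N)
      ≡⟨ solve (m ∷ q ∷ b ∷ z ∷ N ∷ []) ⟩
    q * (q * (1 * (2 * m * (2 * m)) + b * (m * m) + z * (0 * 0))) + 2 * m * N
      ≡⟨ second ⟩
    2 * m * (2 * m * N + q * N)
      ≡⟨ cong (λ t → 2 * m * (2 * m * t + q * t)) q²P≡N ⟨
    2 * m * (2 * m * (q * (q * P)) + q * (q * (q * P)))
      ≡⟨ solve (m ∷ q ∷ P ∷ []) ⟩
    2 * (m * (q * (q * (2 * m * P + q * P)))) ∎))))

index-equation⇒binary : ∀ r {m P} → 2 ≤ m → m * (1 + (2 + r) * P) + P ≡ 2 * m * P + (2 + r) * P → r ≡ 0 × m ≡ P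
index-equation⇒binary zero {m} {P} _ eq = refl , +-cancelʳ-≡ (2 * m * P + P) m P (begin
  m + (2 * m * P + P)  ≡⟨ solve (m ∷ P ∷ []) ⟩
  m * (1 + 2 * P) + P  ≡⟨ eq ⟩
  2 * m * P + 2 * P    ≡⟨ solve (m ∷ P ∷ []) ⟩
  P + (2 * m * P + P)  ∎)
  where open ≡-Reasoning
index-equation⇒binary (suc r) {suc (suc m)} {P} (s≤s (s≤s _)) eq = ⊥-elim (m+1+n≢m _ (trans (sym excess) eq))
  where
  excess : suc (suc m) * (1 + (2 + suc r) * P) + P ≡ 2 * suc (suc m) * P + (2 + suc r) * P + suc (1 + m + (r + m + r * m) * P)
  excess = solve (r ∷ m ∷ P ∷ [])

antipodalCount≡1 : ∀ {r b z P N} → r ≡ 0 → (2 + r) * ((2 + r) * P) ≡ N → N ≡ 1 * 1 + b * 1 + z * 1 →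
  2 + b ≡ 2 * ((2 + r) * P) → z ≡ 1
antipodalCount≡1 {b = b} {z} {P} refl 4P≡N N≡1+b+z 2+b≡4P = +-cancelˡ-≡ (1 + b) z 1 (begin
  1 + b + z              ≡⟨ solve (b ∷ z ∷ []) ⟩
  1 * 1 + b * 1 + z * 1  ≡⟨ trans (sym N≡1+b+z) (sym 4P≡N) ⟩
  2 * (2 * P)            ≡⟨ sym 2+b≡4P ⟩
  2 + b                  ≡⟨ solve (b ∷ []) ⟩
  1 + b + 1              ∎)
  where open ≡-Reasoning

two-distance-arithmetic : ∀ r {n m b z P N} → n ≡ 2 * m → 2 ≤ m →
  (2 + r) * ((2 + r) * P) ≡ N →
  N ≡ 1 * 1 + b * 1 + z * 1 →
  (2 + r) * (1 * n + b * m + z * 0) ≡ n * N →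
  (2 + r) * ((2 + r) * (1 * (n * n) + b * (m * m) + z * (0 * 0))) + n * N ≡ n * (n * N + (2 + r) * N) →
  r ≡ 0 × m ≡ P × z ≡ 1
two-distance-arithmetic r {m = m} {b} {z} {P} {N} refl 2≤m q²P≡N N≡1+b+z first second =
  r≡0 , m≡P , antipodalCount≡1 {r} {b} {z} {P} {N} r≡0 q²P≡N N≡1+b+z 2+b≡2qP
  where
  instance
    m-nonZero : NonZero m
    m-nonZero = >-nonZero (≤-trans (s≤s z≤n) 2≤m)
  2+b≡2qP : 2 + b ≡ 2 * ((2 + r) * P)
  2+b≡2qP = first-moment-reduced {2 + r} {m} {b} {z} {P} {N} q²P≡N first
  r≡0×m≡P : r ≡ 0 × m ≡ P
  r≡0×m≡P = index-equation⇒binary r {m} {P} 2≤m (second-moment-reduced {2 + r} {m} {b} {z} {P} {N} q²P≡N 2+b≡2qP second)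
  r≡0 : r ≡ 0
  r≡0 = proj₁ r≡0×m≡P
  m≡P : m ≡ P
  m≡P = proj₂ r≡0×m≡P

half-bound : ∀ {n m} → n ≡ 2 * m → 4 ≤ n → 2 ≤ m
half-bound {m = zero}        refl ()
half-bound {m = suc zero}    refl (s≤s (s≤s ()))
half-bound {m = suc (suc m)} _    _ = s≤s (s≤s z≤n)

complement : ∀ {n} → Word n 2 → Word n 2
complement x = V.tabulate (λ k → opposite (V.lookup x k))

≢⇒opposite : ∀ {a b : Fin 2} → a ≢ b → a ≡ opposite b
≢⇒opposite {zero}     {zero}     a≢b = ⊥-elim (a≢b refl)
≢⇒opposite {zero}     {suc zero} _   = refl
≢⇒opposite {suc zero} {zero}     _   = refl
≢⇒opposite {suc zero} {suc zero} a≢b = ⊥-elim (a≢b refl)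

agreement≡0⇒complement : ∀ {n} (c x : Word n 2) → agreement c x ≡ 0 → c ≡ complement x
agreement≡0⇒complement c x a≡0 = trans (sym (tabulate∘lookup c)) (tabulate-cong (≢⇒opposite ∘ agreement≡0⇒ c x a≡0))

complement-involutive : ∀ {n} (x : Word n 2) → complement (complement x) ≡ x
complement-involutive x = trans
  (tabulate-cong (λ k → trans (cong opposite (lookup∘tabulate _ k)) (opposite-involutive (V.lookup x k))))
  (tabulate∘lookup x)

sign : Fin 2 → ℤ
sign zero       = + 1
sign (suc zero) = -[1+ 0 ]

sign-±1 : ∀ a → sign a ≡ + 1 ⊎ sign a ≡ -[1+ 0 ]
sign-±1 zero       = inj₁ refl
sign-±1 (suc zero) = inj₂ refl

toSym-sign : ∀ a → toSym (sign a) ≡ a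
toSym-sign zero       = refl
toSym-sign (suc zero) = refl

toSym-negate-sign : ∀ a → toSym (ℤ.- sign a) ≡ opposite a
toSym-negate-sign zero       = refl
toSym-negate-sign (suc zero) = refl

sign*sign : ∀ a b → sign a ℤ.* sign b ℤ.+ + (2 * [ ¬? (a Fin.≟ b) ]) ≡ + 1
sign*sign zero       zero       = refl
sign*sign zero       (suc zero) = refl
sign*sign (suc zero) zero       = refl
sign*sign (suc zero) (suc zero) = refl

sumFin-suc : ∀ {n} (f : Fin (suc n) → ℤ) → sumFin (suc n) f ≡ f zero ℤ.+ sumFin n (f ∘ suc)
sumFin-suc f = cong (λ fs → f zero ℤ.+ foldr ℤ._+_ (+ 0) fs)
  (trans (map-tabulate suc f) (sym (map-tabulate (λ i → i) (f ∘ suc))))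

sumFin+∑ : ∀ {n} (f : Fin n → ℤ) (g : Fin n → ℕ) c → (∀ k → f k ℤ.+ + g k ≡ + c) →
  sumFin n f ℤ.+ + ∑[ k < n ] g k ≡ + (n * c)
sumFin+∑ {zero}  f g c _  = refl
sumFin+∑ {suc n} f g c fg = begin
  sumFin (suc n) f ℤ.+ + (g zero + ∑[ k < n ] g (suc k))
    ≡⟨ cong (ℤ._+ + (g zero + ∑[ k < n ] g (suc k))) (sumFin-suc f) ⟩
  (f zero ℤ.+ sumFin n (f ∘ suc)) ℤ.+ (+ g zero ℤ.+ + ∑[ k < n ] g (suc k))
    ≡⟨ interchange (f zero) (sumFin n (f ∘ suc)) (+ g zero) (+ ∑[ k < n ] g (suc k)) ⟩
  (f zero ℤ.+ + g zero) ℤ.+ (sumFin n (f ∘ suc) ℤ.+ + ∑[ k < n ] g (suc k))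
    ≡⟨ cong₂ ℤ._+_ (fg zero) (sumFin+∑ (f ∘ suc) (g ∘ suc) c (fg ∘ suc)) ⟩
  + (c + n * c) ∎
  where open ≡-Reasoning

signed-inner-product : ∀ {n} (x y : Word n 2) →
  sumFin n (λ k → sign (V.lookup x k) ℤ.* sign (V.lookup y k)) ℤ.+ + (2 * dist x y) ≡ + n
signed-inner-product {n} x y = begin
  sumFin n (λ k → sign (xₖ k) ℤ.* sign (yₖ k)) ℤ.+ + (2 * dist x y)
    ≡⟨ cong (λ d → sumFin n (λ k → sign (xₖ k) ℤ.* sign (yₖ k)) ℤ.+ + d)
         (trans (cong (2 *_) (dist≡∑ x y)) (*-distribˡ-sum 2 (λ k → [ ¬? (xₖ k Fin.≟ yₖ k) ]))) ⟩
  sumFin n (λ k → sign (xₖ k) ℤ.* sign (yₖ k)) ℤ.+ + ∑[ k < n ] (2 * [ ¬? (xₖ k Fin.≟ yₖ k) ])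
    ≡⟨ sumFin+∑ _ _ 1 (λ k → sign*sign (xₖ k) (yₖ k)) ⟩
  + (n * 1)
    ≡⟨ cong +_ (*-identityʳ n) ⟩
  + n ∎
  where
  open ≡-Reasoning
  xₖ yₖ : Fin n → Fin 2
  xₖ = V.lookup x
  yₖ = V.lookup y

module HadamardCode {n m} (C : List (Word n 2)) (unique : Unique C) (n≡2m : n ≡ 2 * m) (degrees : DegreesIn C m n)
  (complement-closed : ∀ {c} → c ∈ C → complement c ∈ C)
  (i₀ : Fin n) (#rows : length (filter (λ c → V.lookup c i₀ Fin.≟ zero) C) ≡ n) where

  private
    _ᵢ₀≟0 : Decidable (λ (c : Word n 2) → V.lookup c i₀ ≡ zero)
    c ᵢ₀≟0 = V.lookup c i₀ Fin.≟ zero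

    C₀ : List (Word n 2)
    C₀ = filter _ᵢ₀≟0 C

  row : Fin n → Word n 2
  row i = lookup C₀ (cast (sym #rows) i)

  row∈C : ∀ i → row i ∈ C
  row∈C i = proj₁ (∈-filter⁻ _ᵢ₀≟0 {xs = C} (∈-lookup (cast (sym #rows) i)))

  rowᵢ₀≡0 : ∀ i → V.lookup (row i) i₀ ≡ zero
  rowᵢ₀≡0 i = proj₂ (∈-filter⁻ _ᵢ₀≟0 {xs = C} (∈-lookup (cast (sym #rows) i)))

  row-injective : ∀ i j → row i ≡ row j → i ≡ j
  row-injective i j rowᵢ≡rowⱼ = begin
    i                                ≡⟨ cast-involutive #rows (sym #rows) i ⟨
    cast #rows (cast (sym #rows) i)  ≡⟨ cong (cast #rows) (lookup-injective (filter⁺ _ᵢ₀≟0 unique) _ _ rowᵢ≡rowⱼ) ⟩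
    cast #rows (cast (sym #rows) j)  ≡⟨ cast-involutive #rows (sym #rows) j ⟩
    j                                ∎
    where open ≡-Reasoning

  row-surjective : ∀ {c} → c ∈ C → V.lookup c i₀ ≡ zero → ∃ λ i → row i ≡ c
  row-surjective {c} c∈C cᵢ₀≡0 = cast #rows (index c∈C₀) ,
    trans (cong (lookup C₀) (cast-involutive (sym #rows) #rows (index c∈C₀))) (sym (lookup-index c∈C₀))
    where
    c∈C₀ : c ∈ C₀
    c∈C₀ = ∈-filter⁺ _ᵢ₀≟0 c∈C cᵢ₀≡0

  rows-at-half-distance : ∀ {i j} → i ≢ j → dist (row i) (row j) ≡ m
  rows-at-half-distance {i} {j} i≢j with degrees (row∈C i) (row∈C j) (i≢j ∘ row-injective i j)
  ... | inj₁ d≡m = d≡m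
  ... | inj₂ d≡n = ⊥-elim (agreement≡0⇒ (row i) (row j) (dist≡n⇒agreement≡0 (row i) (row j) d≡n) i₀
                                        (trans (rowᵢ₀≡0 i) (sym (rowᵢ₀≡0 j))))

  H : Fin n → Fin n → ℤ
  H i k = sign (V.lookup (row i) k)

  H-isHadamard : IsHadamard n H
  H-isHadamard = (λ i k → sign-±1 (V.lookup (row i) k)) , diagonal , off-diagonal
    where
    diagonal : ∀ i → sumFin n (λ k → H i k ℤ.* H i k) ≡ + n
    diagonal i = trans (sym (ℤ.+-identityʳ _))
      (trans (cong (λ d → sumFin n (λ k → H i k ℤ.* H i k) ℤ.+ + (2 * d)) (sym (dist-self (row i))))
             (signed-inner-product (row i) (row i)))
    off-diagonal : ∀ i j → i ≢ j → sumFin n (λ k → H i k ℤ.* H j k) ≡ + 0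
    off-diagonal i j i≢j = identityˡ-unique Sᵢⱼ (+ n) (begin
      Sᵢⱼ ℤ.+ + n
        ≡⟨ cong (λ d → Sᵢⱼ ℤ.+ + d) (trans n≡2m (cong (2 *_) (sym (rows-at-half-distance i≢j)))) ⟩
      Sᵢⱼ ℤ.+ + (2 * dist (row i) (row j))
        ≡⟨ signed-inner-product (row i) (row j) ⟩
      + n ∎)
      where
      open ≡-Reasoning
      Sᵢⱼ : ℤ
      Sᵢⱼ = sumFin n (λ k → H i k ℤ.* H j k)

  row-as-codeword : ∀ i → V.tabulate (λ k → toSym (H i k)) ≡ row i
  row-as-codeword i = trans (tabulate-cong (λ k → toSym-sign (V.lookup (row i) k))) (tabulate∘lookup (row i))

  negated-row-as-codeword : ∀ i → V.tabulate (λ k → toSym (ℤ.- H i k)) ≡ complement (row i)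
  negated-row-as-codeword i = tabulate-cong (λ k → toSym-negate-sign (V.lookup (row i) k))

  ∈⇒InHadamardCode : ∀ {c} → c ∈ C → InHadamardCode H c
  ∈⇒InHadamardCode {c} c∈C with V.lookup c i₀ in cᵢ₀
  ... | zero with row-surjective c∈C cᵢ₀
  ...   | i , rowᵢ≡c = i , inj₁ (sym (trans (row-as-codeword i) rowᵢ≡c))
  ∈⇒InHadamardCode {c} c∈C | suc zero
    with row-surjective (complement-closed c∈C) (trans (lookup∘tabulate _ i₀) (cong opposite cᵢ₀))
  ...   | i , rowᵢ≡c̄ = i , inj₂ (sym (begin
    V.tabulate (λ k → toSym (ℤ.- H i k)) ≡⟨ negated-row-as-codeword i ⟩
    complement (row i)                   ≡⟨ cong complement rowᵢ≡c̄ ⟩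
    complement (complement c)            ≡⟨ complement-involutive c ⟩
    c                                    ∎))
    where open ≡-Reasoning

  InHadamardCode⇒∈ : ∀ {c} → InHadamardCode H c → c ∈ C
  InHadamardCode⇒∈ (i , inj₁ c≡) = subst (_∈ C) (sym (trans c≡ (row-as-codeword i))) (row∈C i)
  InHadamardCode⇒∈ (i , inj₂ c≡) = subst (_∈ C) (sym (trans c≡ (negated-row-as-codeword i))) (complement-closed (row∈C i))

module TwoDistanceDesign {n m r} (C : List (Word n (2 + r))) (unique : Unique C) (design : IsDesign 3 C)
  (n≡2m : n ≡ 2 * m) (4≤n : 4 ≤ n) (degrees : DegreesIn C m n) where

  private
    2≤m : 2 ≤ m
    2≤m = half-bound n≡2m 4≤n

    3≤n : 3 ≤ n
    3≤n = ≤-trans (n≤1+n 3) 4≤n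

  open Design C design 3≤n public

  i₀ j₀ : Fin n
  i₀ = fromℕ< (≤-trans (s≤s z≤n) 4≤n)
  j₀ = proj₁ (fresh 3≤n i₀ i₀)

  i₀≢j₀ : i₀ ≢ j₀
  i₀≢j₀ = proj₁ (proj₂ (fresh 3≤n i₀ i₀))

  module _ {x} (x∈C : x ∈ C) where
    open TwoDistance C unique n≡2m (m<n⇒n≢0 2≤m) degrees x∈C public
    open Moments x

    binary-with-unique-antipode : r ≡ 0 × m ≡ pairCount i₀ j₀ zero zero × antipodalCount ≡ 1
    binary-with-unique-antipode =
      two-distance-arithmetic r {n} {m} {halfCount} {antipodalCount} {pairCount i₀ j₀ zero zero} {N}
        n≡2m 2≤m (pairCount-index i₀≢j₀ zero zero) size first second
      where
      size : N ≡ 1 * 1 + halfCount * 1 + antipodalCount * 1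
      size = trans (sym (trans (∑-const N 1) (*-identityʳ N))) (moment-decomposition (λ _ → 1))
      first : (2 + r) * (1 * n + halfCount * m + antipodalCount * 0) ≡ n * N
      first = trans (cong ((2 + r) *_) (sym (moment-decomposition (λ a → a)))) firstMoment
      second : (2 + r) * ((2 + r) * (1 * (n * n) + halfCount * (m * m) + antipodalCount * (0 * 0))) + n * N
             ≡ n * (n * N + (2 + r) * N)
      second = trans (cong (λ t → (2 + r) * ((2 + r) * t) + n * N) (sym (moment-decomposition (λ a → a * a)))) secondMoment

module BinaryTwoDistanceDesign {n m} (C : List (Word n 2)) (unique : Unique C) (design : IsDesign 3 C)
  (n≡2m : n ≡ 2 * m) (4≤n : 4 ≤ n) (degrees : DegreesIn C m n) {x} (x∈C : x ∈ C) where

  open TwoDistanceDesign C unique design n≡2m 4≤n degrees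

  unique-antipode : ∀ {c} (c∈C : c ∈ C) → antipodalCount c∈C ≡ 1
  unique-antipode c∈C = proj₂ (proj₂ (binary-with-unique-antipode c∈C))

  m≡index : m ≡ pairCount i₀ j₀ zero zero
  m≡index = proj₁ (proj₂ (binary-with-unique-antipode x∈C))

  complement-closed : ∀ {c} → c ∈ C → complement c ∈ C
  complement-closed {c} c∈C with ∑≢0⇒ _ (λ z≡0 → 1+n≢0 (trans (sym (unique-antipode c∈C)) z≡0))
  ... | l , [a≟0]≢0 = subst (_∈ C)
    (agreement≡0⇒complement (lookup C l) c ([]≢0⇒ (agreement (lookup C l) c ℕ.≟ 0) [a≟0]≢0)) (∈-lookup l)

  #rows : length (filter (λ c → V.lookup c i₀ Fin.≟ zero) C) ≡ n
  #rows = *-cancelˡ-≡ _ _ 2 (begin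
    2 * length (filter (λ c → V.lookup c i₀ Fin.≟ zero) C)  ≡⟨ cong (2 *_) (length-filter _ C) ⟩
    2 * count i₀ zero                                        ≡⟨ count-index i₀ zero ⟩
    N                                                        ≡⟨ pairCount-index i₀≢j₀ zero zero ⟨
    2 * (2 * pairCount i₀ j₀ zero zero)                      ≡⟨ cong (λ P → 2 * (2 * P)) m≡index ⟨
    2 * (2 * m)                                              ≡⟨ cong (2 *_) n≡2m ⟨
    2 * n                                                    ∎)
    where open ≡-Reasoning

  open HadamardCode C unique n≡2m degrees complement-closed i₀ #rows public

map-isoMap-id : ∀ {n q} (C : List (Word n q)) → map (isoMap Perm.id (λ _ → Perm.id)) C ≡ C
map-isoMap-id C = trans (map-cong tabulate∘lookup C) (map-id C)

theorem4p11 : (n m r : ℕ) → n ≡ 2 * m → 4 ≤ n →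
    (C : List (Word n (suc (suc r)))) → Unique C → C ≢ [] →
    IsDesign 3 C →
    ((d : ℕ) → InDegreeSet C d ⇔ (d ≡ m ⊎ d ≡ n)) →
    Σ (Fin n → Fin n → ℤ) λ H → IsHadamard n H ×
      Σ (Permutation′ n) λ σ → Σ (Fin n → Permutation′ (suc (suc r))) λ π →
        ((y : Word n (suc (suc r))) → (y ∈ map (isoMap σ π) C) ⇔ InHadamardCode H y)
theorem4p11 n m (suc r) n≡2m 4≤n C unique C≢[] design degree-set =
  ⊥-elim (1+n≢0 (proj₁ (binary-with-unique-antipode (proj₂ (nonempty C≢[])))))
  where
  open TwoDistanceDesign C unique design n≡2m 4≤n (degreeSet⇒DegreesIn degree-set)
theorem4p11 n m zero n≡2m 4≤n C unique C≢[] design degree-set =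
  H , H-isHadamard , Perm.id , (λ _ → Perm.id) , λ y →
    subst (λ D → (y ∈ D) ⇔ InHadamardCode H y) (sym (map-isoMap-id C))
      (mk⇔ ∈⇒InHadamardCode InHadamardCode⇒∈)
  where
  open BinaryTwoDistanceDesign C unique design n≡2m 4≤n (degreeSet⇒DegreesIn degree-set) (proj₂ (nonempty C≢[]))
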